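{- Let $Q$ be a graph with components $Q_1,\dots,Q_s$ and $\chi(Q)=t$. Then there exists a vertex $u_i\in V(Q_i)$ for each $i\in\{1,\dots,s\}$ such that $$\sum_{i=1}^s d_Q(u_i)\le\frac{t-1}{t}|V(Q)|.$$
   Context: $d_Q(u)$ is the degree of $u$ in $Q$; $\chi$ is the chromatic number. -}

module Defs where

open import Data.Nat using (ℕ; zero; suc; _+_; _*_; _∸_; _≤_; _<_)
open import Data.Fin using (Fin; _≟_)
open import Data.Bool using (Bool; true; false)
open import Data.Nat.ListAction using (sum)
open import Data.List using (List; map; filter; length; allFin)
open import Data.Product using (Σ; ∃; _×_; _,_)
open import Relation.Binary.PropositionalEquality using (_≡_; _≢_)
open import Relation.Nullary using (¬_; yes; no)
open import Data.Bool.Properties using () renaming (_≟_ to _≟ᵇ_)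

record Graph (n : ℕ) : Set where
  field
    adj       : Fin n → Fin n → Bool
    adj-sym   : ∀ u v → adj u v ≡ adj v u
    adj-irrefl : ∀ v → adj v v ≡ false

open Graph public

Adj : ∀ {n} → Graph n → Fin n → Fin n → Set
Adj G u v = adj G u v ≡ true

degree : ∀ {n} → Graph n → Fin n → ℕ
degree {n} G u = length (filter (λ v → adj G u v ≟ᵇ true) (allFin n))

data Connected {n : ℕ} (G : Graph n) : Fin n → Fin n → Set where
  here : ∀ {u} → Connected G u u
  step : ∀ {u v w} → Adj G u v → Connected G v w → Connected G u w

-- A choice of one vertex in each component: r maps every vertex to the
-- chosen vertex of its component.  The chosen vertices are exactly the
-- fixed points of r, one per component.
record ComponentChoice {n : ℕ} (G : Graph n) : Set where
  field
    rep      : Fin n → Fin n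
    rep-conn : ∀ v → Connected G v (rep v)
    rep-same : ∀ u v → Connected G u v → rep u ≡ rep v

open ComponentChoice public

chosenDegreeSum : ∀ {n} (G : Graph n) → ComponentChoice G → ℕ
chosenDegreeSum {n} G c =
  sum (map (degree G) (filter (λ v → rep c v ≟ v) (allFin n)))

ProperColouring : ∀ {n} → Graph n → ℕ → Set
ProperColouring {n} G k =
  Σ (Fin n → Fin k) λ col → ∀ u v → Adj G u v → col u ≢ col v

Colourable : ∀ {n} → Graph n → ℕ → Set
Colourable G k = ProperColouring G k

ChromaticNumber : ∀ {n} → Graph n → ℕ → Set
ChromaticNumber G t = Colourable G t × (∀ k → k < t → ¬ Colourable G k)

module Submission where

-- For each component K, choose a vertex x of K in a largest colour class of K.  A proper
-- t-colouring splits K into t classes, so this class has at least |K|/t vertices, and x has no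
-- neighbours in its own class nor outside K, whence t·d(x) ≤ (t-1)|K|.  Summing over the
-- components, whose sizes add up to |V(Q)|, gives the bound.  Components are computed as the
-- closure of a singleton under adjacency, by well-founded recursion on strict inclusion.

open import Level using (Level)
open import Function using (_∘_; id)
open import Data.Bool using (true; false; if_then_else_)
import Data.Bool.Properties as Bool
open import Data.Empty using (⊥-elim-irr)
open import Data.Unit using (tt)
open import Data.Product using (Σ; ∃; ∃-syntax; _×_; _,_; proj₁; proj₂)
open import Data.Sum using (inj₁; inj₂)
open import Data.Nat using (ℕ; zero; suc; _+_; _*_; _∸_; _≤_; _<_; z≤n)
open import Data.Nat.Properties
  using ( +-*-semiring; ≤-refl; ≤-trans; ≤-reflexive; +-mono-≤; *-monoʳ-≤; m≤m+n; m+n∸m≡n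
        ; ∸-monoʳ-≤; >⇒≢; *-distribˡ-+; *-distribʳ-∸; *-identityˡ; *-zeroʳ; module ≤-Reasoning)
open import Data.Nat.ListAction using (sum)
open import Data.Fin using (Fin; zero; suc; _≟_; punchIn)
open import Data.Fin.Properties using (any?; punchInᵢ≢i)
open import Data.Fin.Subset using (Subset; Nonempty; _∈_; _∉_; _⊆_; _⊂_; _⊃_; _∪_; ⁅_⁆)
open import Data.Fin.Subset.Properties
  using (_∈?_; p⊆p∪q; q⊆p∪q; x∈⁅x⁆; x∈⁅y⁆⇒x≡y; x∈p∪q⁻; ⊆-antisym)
open import Data.Fin.Subset.Induction using (⊃-wellFounded)
open import Data.List using (map; filter; length; tabulate; allFin)
open import Data.List.Extrema.Nat using (argmax; f[xs]≤f[argmax])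
import Data.List.Relation.Unary.All as All
open import Data.List.Membership.Propositional.Properties using (∈-allFin)
open import Induction.WellFounded using (Acc; acc)
open import Relation.Binary.PropositionalEquality
open import Relation.Nullary using (Dec; yes; no; does; _×-dec_; ¬?; contradiction)
open import Relation.Nullary.Decidable using (dec-true; dec-false; decidable-stable)
open import Relation.Unary using (Pred; Decidable)
open import Algebra.Properties.Semiring.Sum +-*-semiring
  using ( sum-syntax; sum-cong-≗; sum-remove; sum-replicate-zero; ∑-comm; ∑-distrib-+
        ; *-distribˡ-sum)
  renaming (sum to ∑)
open import Defs

private variable
  a b p q : Level
  A : Set a
  B : Set b
  n t : ℕ

𝟙 : Dec A → ℕ
𝟙 a? = if does a? then 1 else 0

𝟙-mono : (A → B) → (a? : Dec A) (b? : Dec B) → 𝟙 a? ≤ 𝟙 b?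
𝟙-mono f (no _)  _       = z≤n
𝟙-mono f (yes a) (yes _) = ≤-refl
𝟙-mono f (yes a) (no ¬b) = contradiction (f a) ¬b

𝟙-split : (a? : Dec A) (b? : Dec B) → 𝟙 a? ≡ 𝟙 (a? ×-dec b?) + 𝟙 (a? ×-dec ¬? b?)
𝟙-split (no _)  _       = refl
𝟙-split (yes _) (yes _) = refl
𝟙-split (yes _) (no _)  = refl

∑-mono-≤ : {f g : Fin n → ℕ} → (∀ i → f i ≤ g i) → ∑ f ≤ ∑ g
∑-mono-≤ {zero}  f≤g = z≤n
∑-mono-≤ {suc n} f≤g = +-mono-≤ (f≤g zero) (∑-mono-≤ (f≤g ∘ suc))

∑-≤-* : {f : Fin n → ℕ} {m : ℕ} → (∀ i → f i ≤ m) → ∑ f ≤ n * m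
∑-≤-* {zero}  f≤m = z≤n
∑-≤-* {suc n} f≤m = +-mono-≤ (f≤m zero) (∑-≤-* (f≤m ∘ suc))

term≤∑ : (f : Fin n → ℕ) (i : Fin n) → f i ≤ ∑ f
term≤∑ {suc n} f i = ≤-trans (m≤m+n (f i) _) (≤-reflexive (sym (sum-remove {i = i} f)))

∑-𝟙-≟ : (i : Fin n) → ∑[ j < n ] 𝟙 (i ≟ j) ≡ 1
∑-𝟙-≟ {suc n} i = begin
  ∑[ j < suc n ] 𝟙 (i ≟ j)                     ≡⟨ sum-remove {i = i} (λ j → 𝟙 (i ≟ j)) ⟩
  𝟙 (i ≟ i) + ∑[ j < n ] 𝟙 (i ≟ punchIn i j)   ≡⟨ cong₂ _+_ 𝟙-refl (sum-cong-≗ 𝟙-punchIn) ⟩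
  1 + ∑[ j < n ] 0                             ≡⟨ cong suc (sum-replicate-zero n) ⟩
  1                                            ∎
  where
  open ≡-Reasoning
  𝟙-refl : 𝟙 (i ≟ i) ≡ 1
  𝟙-refl = cong (if_then 1 else 0) (dec-true (i ≟ i) refl)
  𝟙-punchIn : ∀ j → 𝟙 (i ≟ punchIn i j) ≡ 0
  𝟙-punchIn j = cong (if_then 1 else 0) (dec-false (i ≟ punchIn i j) (punchInᵢ≢i i j ∘ sym))

𝟙-fibres : (a? : Dec A) (c : Fin t) → 𝟙 a? ≡ ∑[ d < t ] 𝟙 (a? ×-dec c ≟ d)
𝟙-fibres (yes _) c = sym (∑-𝟙-≟ c)
𝟙-fibres {t = t} (no _) c = sym (sum-replicate-zero t)

count : {P : Pred (Fin n) p} → Decidable P → ℕ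
count P? = ∑[ i < _ ] 𝟙 (P? i)

module _ {P : Pred (Fin n) p} (P? : Decidable P) where

  count-mono : {Q : Pred (Fin n) q} (Q? : Decidable Q) → (∀ {i} → P i → Q i) → count P? ≤ count Q?
  count-mono Q? P⊆Q = ∑-mono-≤ (λ i → 𝟙-mono P⊆Q (P? i) (Q? i))

  count-split : {Q : Pred (Fin n) q} (Q? : Decidable Q) →
    count P? ≡ count (λ i → P? i ×-dec Q? i) + count (λ i → P? i ×-dec ¬? (Q? i))
  count-split Q? = trans (sum-cong-≗ (λ i → 𝟙-split (P? i) (Q? i)))
                         (∑-distrib-+ (λ i → 𝟙 (P? i ×-dec Q? i)) (λ i → 𝟙 (P? i ×-dec ¬? (Q? i))))

  count-fibres : (f : Fin n → Fin t) → count P? ≡ ∑[ c < t ] count (λ i → P? i ×-dec f i ≟ c)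
  count-fibres f = trans (sum-cong-≗ (λ i → 𝟙-fibres (P? i) (f i)))
                         (∑-comm (λ i c → 𝟙 (P? i ×-dec f i ≟ c)))

  ∈⇒0<count : ∀ {i} → P i → 0 < count P?
  ∈⇒0<count {i} Pi = ≤-trans (≤-reflexive (cong (if_then 1 else 0) (sym (dec-true (P? i) Pi))))
                              (term≤∑ (λ j → 𝟙 (P? j)) i)

  0<count⇒∃ : 0 < count P? → ∃ P
  0<count⇒∃ pos with any? P?
  ... | yes ∃P  = ∃P
  ... | no ¬∃P = contradiction count≡0 (>⇒≢ pos)
    where
    count≡0 : count P? ≡ 0
    count≡0 = trans (sum-cong-≗ (λ i → cong (if_then 1 else 0) (dec-false (P? i) (¬∃P ∘ (i ,_)))))
                    (sum-replicate-zero n)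

count-⊤ : count {n} (λ _ → yes tt) ≡ n
count-⊤ {zero}  = refl
count-⊤ {suc n} = cong suc (count-⊤ {n})

∑-count-fibres : (f : Fin n → Fin t) → ∑[ c < t ] count (λ i → f i ≟ c) ≡ n
∑-count-fibres f = trans (sym (count-fibres (λ _ → yes tt) f)) count-⊤

module _ {P : Pred A p} (P? : Decidable P) where

  length-filter-tabulate : (f : Fin n → A) → length (filter P? (tabulate f)) ≡ count (P? ∘ f)
  length-filter-tabulate {zero}  f = refl
  length-filter-tabulate {suc n} f with does (P? (f zero))
  ... | true  = cong suc (length-filter-tabulate (f ∘ suc))
  ... | false = length-filter-tabulate (f ∘ suc)

  sum-map-filter-tabulate : (g : A → ℕ) (f : Fin n → A) →
    sum (map g (filter P? (tabulate f))) ≡ ∑[ i < n ] (if does (P? (f i)) then g (f i) else 0)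
  sum-map-filter-tabulate {zero}  g f = refl
  sum-map-filter-tabulate {suc n} g f with does (P? (f zero))
  ... | true  = cong (g (f zero) +_) (sum-map-filter-tabulate g (f ∘ suc))
  ... | false = sum-map-filter-tabulate g (f ∘ suc)

S⊂S∪⁅w⁆ : ∀ {S : Subset n} {w} → w ∉ S → S ⊂ S ∪ ⁅ w ⁆
S⊂S∪⁅w⁆ {S = S} {w} w∉S = p⊆p∪q ⁅ w ⁆ , w , q⊆p∪q S ⁅ w ⁆ (x∈⁅x⁆ w) , w∉S

module _ (G : Graph n) where

  connected-snoc : ∀ {u v w} → Connected G u v → Adj G v w → Connected G u w
  connected-snoc here        vw = step vw here
  connected-snoc (step uv c) vw = step uv (connected-snoc c vw)

  connected-trans : ∀ {u v w} → Connected G u v → Connected G v w → Connected G u w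
  connected-trans here        c = c
  connected-trans (step uv c) d = step uv (connected-trans c d)

  connected-sym : ∀ {u v} → Connected G u v → Connected G v u
  connected-sym here                = here
  connected-sym (step {u} {v} uv c) = connected-snoc (connected-sym c) (trans (adj-sym G v u) uv)

  Closed : Subset n → Set
  Closed S = ∀ {v w} → v ∈ S → Adj G v w → w ∈ S

  closed-reach : ∀ {S v w} → Closed S → v ∈ S → Connected G v w → w ∈ S
  closed-reach closed v∈S here        = v∈S
  closed-reach closed v∈S (step vv′ c) = closed-reach closed (closed v∈S vv′) c

  LeavingEdge : Subset n → Set
  LeavingEdge S = ∃[ w ] w ∉ S × ∃[ v ] v ∈ S × Adj G v w

  leavingEdge? : (S : Subset n) → Dec (LeavingEdge S)
  leavingEdge? S = any? λ w → ¬? (w ∈? S) ×-dec any? λ v → v ∈? S ×-dec adj G v w Bool.≟ true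

  closure : (S : Subset n) → Acc _⊃_ S → Subset n
  closure S (acc rs) with leavingEdge? S
  ... | yes (w , w∉S , _) = closure (S ∪ ⁅ w ⁆) (rs (S⊂S∪⁅w⁆ w∉S))
  ... | no _              = S

  ⊆-closure : ∀ {S} (acc-S : Acc _⊃_ S) → S ⊆ closure S acc-S
  ⊆-closure {S} (acc rs) with leavingEdge? S
  ... | yes (w , _) = ⊆-closure (rs _) ∘ p⊆p∪q ⁅ w ⁆
  ... | no _        = id

  closure-closed : ∀ {S} (acc-S : Acc _⊃_ S) → Closed (closure S acc-S)
  closure-closed {S} (acc rs) {v} {w} v∈S vw with leavingEdge? S
  ... | yes _ = closure-closed (rs _) v∈S vw
  ... | no ¬e = decidable-stable (w ∈? S) (λ w∉S → ¬e (w , w∉S , v , v∈S , vw))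

  closure-reachable : ∀ {u S} (acc-S : Acc _⊃_ S) →
    (∀ {v} → v ∈ S → Connected G u v) → ∀ {w} → w ∈ closure S acc-S → Connected G u w
  closure-reachable {u} {S} (acc rs) reach with leavingEdge? S
  ... | no _ = reach
  ... | yes (w , _ , v , v∈S , vw) = closure-reachable (rs _) reach′
    where
    reach′ : ∀ {x} → x ∈ S ∪ ⁅ w ⁆ → Connected G u x
    reach′ {x} x∈ with x∈p∪q⁻ S ⁅ w ⁆ x∈
    ... | inj₁ x∈S = reach x∈S
    ... | inj₂ x∈w rewrite x∈⁅y⁆⇒x≡y w x∈w = connected-snoc (reach v∈S) vw

  component : Fin n → Subset n
  component u = closure ⁅ u ⁆ (⊃-wellFounded ⁅ u ⁆)

  component-closed : ∀ u → Closed (component u)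
  component-closed u = closure-closed (⊃-wellFounded ⁅ u ⁆)

  ∈-component⁻ : ∀ {u w} → w ∈ component u → Connected G u w
  ∈-component⁻ {u} = closure-reachable (⊃-wellFounded ⁅ u ⁆)
    λ v∈u → subst (Connected G u) (sym (x∈⁅y⁆⇒x≡y u v∈u)) here

  ∈-component⁺ : ∀ {u w} → Connected G u w → w ∈ component u
  ∈-component⁺ {u} = closed-reach (component-closed u) (⊆-closure (⊃-wellFounded ⁅ u ⁆) (x∈⁅x⁆ u))

  component-cong : ∀ {u v} → Connected G u v → component u ≡ component v
  component-cong uv = ⊆-antisym
    (λ w∈u → ∈-component⁺ (connected-trans (connected-sym uv) (∈-component⁻ w∈u)))
    (λ w∈v → ∈-component⁺ (connected-trans uv (∈-component⁻ w∈v)))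

-- The existence proof is irrelevant, so `pick P? _` depends on P? alone: this is what makes the
-- vertex chosen for a component independent of the vertex it was reached from (choose-cong).
pick : {P : Pred (Fin n) p} → Decidable P → .(∃ P) → Fin n
pick P? ∃P with any? P?
... | yes (i , _) = i
... | no ¬∃P      = ⊥-elim-irr (¬∃P ∃P)

pick-satisfies : {P : Pred (Fin n) p} (P? : Decidable P) .(∃P : ∃ P) → P (pick P? ∃P)
pick-satisfies P? ∃P with any? P?
... | yes (_ , Pi) = Pi
... | no ¬∃P       = ⊥-elim-irr (¬∃P ∃P)

m+r≤t*m⇒t*r≤[t∸1]*[m+r] : ∀ t m r → m + r ≤ t * m → t * r ≤ (t ∸ 1) * (m + r)
m+r≤t*m⇒t*r≤[t∸1]*[m+r] t m r m+r≤t*m = begin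
  t * r                        ≡⟨ m+n∸m≡n (t * m) (t * r) ⟨
  (t * m + t * r) ∸ t * m      ≤⟨ ∸-monoʳ-≤ (t * m + t * r) m+r≤t*m ⟩
  (t * m + t * r) ∸ (m + r)    ≡⟨ cong₂ _∸_ (*-distribˡ-+ t m r) (*-identityˡ (m + r)) ⟨
  t * (m + r) ∸ 1 * (m + r)    ≡⟨ *-distribʳ-∸ (m + r) t 1 ⟨
  (t ∸ 1) * (m + r)            ∎
  where open ≤-Reasoning

module MajorityChoice (col : Fin n → Fin t) where

  classSize : Subset n → Fin t → ℕ
  classSize S c = count (λ v → v ∈? S ×-dec col v ≟ c)

  majority : (S : Subset n) → .(Nonempty S) → Fin t
  majority S ne = argmax (classSize S) (col (pick (_∈? S) ne)) (allFin t)

  classSize≤majority : ∀ S .ne c → classSize S c ≤ classSize S (majority S ne)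
  classSize≤majority S ne c =
    All.lookup (f[xs]≤f[argmax] {f = classSize S} (col (pick (_∈? S) ne)) (allFin t)) (∈-allFin c)

  ∣S∣≤t*majority : ∀ S .ne → count (_∈? S) ≤ t * classSize S (majority S ne)
  ∣S∣≤t*majority S ne =
    ≤-trans (≤-reflexive (count-fibres (_∈? S) col)) (∑-≤-* (classSize≤majority S ne))

  majority-inhabited : ∀ S .ne → ∃[ v ] v ∈ S × col v ≡ majority S ne
  majority-inhabited S ne = 0<count⇒∃ (λ v → v ∈? S ×-dec col v ≟ majority S ne)
    (≤-trans (∈⇒0<count (λ v → v ∈? S ×-dec col v ≟ c₀) (pick-satisfies (_∈? S) ne , refl))
             (classSize≤majority S ne c₀))
    where c₀ = col (pick (_∈? S) ne)

  choose : (S : Subset n) → .(Nonempty S) → Fin n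
  choose S ne = pick (λ v → v ∈? S ×-dec col v ≟ majority S ne) (majority-inhabited S ne)

  choose-∈ : ∀ S .ne → choose S ne ∈ S
  choose-∈ S ne =
    proj₁ (pick-satisfies (λ v → v ∈? S ×-dec col v ≟ majority S ne) (majority-inhabited S ne))

  choose-colour : ∀ S .ne → col (choose S ne) ≡ majority S ne
  choose-colour S ne =
    proj₂ (pick-satisfies (λ v → v ∈? S ×-dec col v ≟ majority S ne) (majority-inhabited S ne))

  choose-cong : ∀ {S T} .{ne : Nonempty S} .{ne′ : Nonempty T} → S ≡ T → choose S ne ≡ choose T ne′
  choose-cong refl = refl

module _ (G : Graph n) (col : Fin n → Fin t) (proper : ∀ u v → Adj G u v → col u ≢ col v) where

  open MajorityChoice col

  degree≡count : ∀ x → degree G x ≡ count (λ v → adj G x v Bool.≟ true)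
  degree≡count x = length-filter-tabulate (λ v → adj G x v Bool.≟ true) id

  choose-degree : ∀ S .ne → Closed G S → t * degree G (choose S ne) ≤ (t ∸ 1) * count (_∈? S)
  choose-degree S ne closed = begin
    t * degree G x           ≤⟨ *-monoʳ-≤ t degree≤r ⟩
    t * r                    ≤⟨ m+r≤t*m⇒t*r≤[t∸1]*[m+r] t m r m+r≤t*m ⟩
    (t ∸ 1) * (m + r)        ≡⟨ cong ((t ∸ 1) *_) ∣S∣≡m+r ⟨
    (t ∸ 1) * count (_∈? S)  ∎
    where
    open ≤-Reasoning
    x = choose S ne
    c = majority S ne
    m = classSize S c
    outside-class? = λ v → v ∈? S ×-dec ¬? (col v ≟ c)
    r = count outside-class?
    ∣S∣≡m+r : count (_∈? S) ≡ m + r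
    ∣S∣≡m+r = count-split (_∈? S) (λ v → col v ≟ c)
    m+r≤t*m : m + r ≤ t * m
    m+r≤t*m = ≤-trans (≤-reflexive (sym ∣S∣≡m+r)) (∣S∣≤t*majority S ne)
    neighbour-outside-class : ∀ {v} → Adj G x v → v ∈ S × col v ≢ c
    neighbour-outside-class {v} xv =
      closed (choose-∈ S ne) xv , λ colv≡c → proper x v xv (trans (choose-colour S ne) (sym colv≡c))
    degree≤r : degree G x ≤ r
    degree≤r = ≤-trans (≤-reflexive (degree≡count x))
      (count-mono (λ v → adj G x v Bool.≟ true) outside-class? neighbour-outside-class)

  representative : Fin n → Fin n
  representative v = choose (component G v) (v , ∈-component⁺ G here)

  majorityChoice : ComponentChoice G
  majorityChoice = record
    { rep      = representative
    ; rep-conn = λ v → ∈-component⁻ G (choose-∈ (component G v) (v , ∈-component⁺ G here))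
    ; rep-same = λ u v uv → choose-cong (component-cong G uv)
    }

  fixed-degree : ∀ x → representative x ≡ x →
    t * degree G x ≤ (t ∸ 1) * count (λ v → representative v ≟ x)
  fixed-degree x fixed = begin
    t * degree G x                                ≡⟨ cong (λ y → t * degree G y) fixed ⟨
    t * degree G (representative x)               ≤⟨ choose-degree (component G x) _ (component-closed G x) ⟩
    (t ∸ 1) * count (_∈? component G x)           ≤⟨ *-monoʳ-≤ (t ∸ 1) component≤fibre ⟩
    (t ∸ 1) * count (λ v → representative v ≟ x)  ∎
    where
    open ≤-Reasoning
    in-fibre : ∀ {v} → v ∈ component G x → representative v ≡ x
    in-fibre v∈x = trans (sym (rep-same majorityChoice _ _ (∈-component⁻ G v∈x))) fixed
    component≤fibre : count (_∈? component G x) ≤ count (λ v → representative v ≟ x)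
    component≤fibre = count-mono (_∈? component G x) (λ v → representative v ≟ x) in-fibre

  t*chosenDegreeSum≤[t∸1]*n : t * chosenDegreeSum G majorityChoice ≤ (t ∸ 1) * n
  t*chosenDegreeSum≤[t∸1]*n = begin
    t * chosenDegreeSum G majorityChoice
      ≡⟨ cong (t *_) (sum-map-filter-tabulate (λ v → representative v ≟ v) (degree G) id) ⟩
    t * ∑[ x < n ] chosenDegree x           ≡⟨ *-distribˡ-sum t chosenDegree ⟩
    ∑[ x < n ] (t * chosenDegree x)         ≤⟨ ∑-mono-≤ bound ⟩
    ∑[ x < n ] ((t ∸ 1) * fibre x)          ≡⟨ *-distribˡ-sum (t ∸ 1) fibre ⟨
    (t ∸ 1) * ∑[ x < n ] fibre x            ≡⟨ cong ((t ∸ 1) *_) (∑-count-fibres representative) ⟩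
    (t ∸ 1) * n                             ∎
    where
    open ≤-Reasoning
    chosenDegree fibre : Fin n → ℕ
    chosenDegree x = if does (representative x ≟ x) then degree G x else 0
    fibre x = count (λ v → representative v ≟ x)
    bound : ∀ x → t * chosenDegree x ≤ (t ∸ 1) * fibre x
    bound x = masked (representative x ≟ x)
      where
      masked : (fixed? : Dec (representative x ≡ x)) →
        t * (if does fixed? then degree G x else 0) ≤ (t ∸ 1) * fibre x
      masked (yes fixed) = fixed-degree x fixed
      masked (no _)      = ≤-trans (≤-reflexive (*-zeroʳ t)) z≤n

lemma3p3 : (n : ℕ) (Q : Graph n) (t : ℕ) → ChromaticNumber Q t →
    Σ (ComponentChoice Q) λ c → t * chosenDegreeSum Q c ≤ (t ∸ 1) * n
lemma3p3 n Q t ((col , proper) , _) =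
  majorityChoice Q col proper , t*chosenDegreeSum≤[t∸1]*n Q col proper
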